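{- For every positive integer $n$ we have $f(n,1)=h(n,1)=n$.
   Context: An antichain in $2^{[n]}$ (where $[n]=\{1,\dots,n\}$) is a family of subsets of $[n]$ none of which is contained in another. There is an unknown ("hidden") antichain $\mathcal{S}\subseteq 2^{[n]}$ with exactly $k$ members. A query is a set $Q\subseteq[n]$, and the answer to $Q$ is YES if $Q\supseteq S$ for at least one $S\in\mathcal{S}$, and NO otherwise. $f(n,k)$ denotes the smallest number $q$ such that there is an adaptive strategy (each query may depend on the answers to the previous ones) which, for every $k$-member antichain $\mathcal{S}$, determines $\mathcal{S}$ uniquely using at most $q$ queries. $h(n,k)$ denotes the smallest size of a family $\mathcal{G}\subseteq 2^{[n]}$ (non-adaptive queries) such that for any two distinct $k$-member antichains $\mathcal{H},\mathcal{H}'$ in $2^{[n]}$ there is $G\in\mathcal{G}$ whose answer differs for $\mathcal{H}$ and $\mathcal{H}'$, i.e. $G$ contains a member of one of them but no member of the other. -}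

module Defs where

open import Data.Nat using (ℕ; _≤_)
open import Data.Bool using (Bool; true; false)
open import Data.Fin.Subset using (Subset; _⊆_)
open import Data.Fin.Subset.Properties using (_⊆?_)
open import Data.List using (List; []; _∷_; length)
open import Data.List.Membership.Propositional using (_∈_)
open import Data.List.Relation.Unary.Any using (any?)
open import Data.List.Relation.Unary.Unique.Propositional using (Unique)
open import Data.Product using (Σ; _×_; ∃)
open import Relation.Nullary using (¬_; does)
open import Relation.Binary.PropositionalEquality using (_≡_; _≢_)
open import Function.Bundles using (_⇔_)

-- A family of subsets of [n], represented as a duplicate-free list.
Family : ℕ → Set
Family n = List (Subset n)

_≈F_ : ∀ {n} → Family n → Family n → Set
F ≈F F' = ∀ S → (S ∈ F) ⇔ (S ∈ F')

IsKAntichain : ∀ {n} → ℕ → Family n → Set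
IsKAntichain k F =
  Unique F × length F ≡ k × (∀ {S T} → S ∈ F → T ∈ F → S ⊆ T → S ≡ T)

answer : ∀ {n} → Family n → Subset n → Bool
answer F Q = does (any? (λ S → S ⊆? Q) F)

-- Adaptive strategies as binary decision trees: at a node the query Q
-- is asked; go to the first subtree on YES, the second on NO.
data Strategy (n : ℕ) : Set where
  stop : Strategy n
  ask  : Subset n → Strategy n → Strategy n → Strategy n

-- Sequence of answers obtained by running the strategy against F
-- (its length is the number of queries asked).
run : ∀ {n} → Strategy n → Family n → List Bool
run stop F = []
run (ask Q y m) F with answer F Q
... | true  = true  ∷ run y F
... | false = false ∷ run m F

AdaptiveSolves : (n k q : ℕ) → Strategy n → Set
AdaptiveSolves n k q t =
  (∀ F → IsKAntichain k F → length (run t F) ≤ q) ×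
  (∀ F F' → IsKAntichain k F → IsKAntichain k F' → run t F ≡ run t F' → F ≈F F')

AdaptiveOK : (n k q : ℕ) → Set
AdaptiveOK n k q = Σ (Strategy n) (AdaptiveSolves n k q)

Separating : (n k : ℕ) → Family n → Set
Separating n k 𝒢 = ∀ H H' → IsKAntichain k H → IsKAntichain k H' → ¬ (H ≈F H') →
  Σ (Subset n) (λ G → G ∈ 𝒢 × answer H G ≢ answer H' G)

NonAdaptiveOK : (n k q : ℕ) → Set
NonAdaptiveOK n k q = Σ (Family n) (λ 𝒢 → Unique 𝒢 × length 𝒢 ≡ q × Separating n k 𝒢)

IsLeast : (ℕ → Set) → ℕ → Set
IsLeast P m = P m × (∀ q → P q → m ≤ q)

f-is : (n k m : ℕ) → Set
f-is n k m = IsLeast (AdaptiveOK n k) m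

h-is : (n k m : ℕ) → Set
h-is n k m = IsLeast (NonAdaptiveOK n k) m

{-# OPTIONS --safe #-}
-- Upper bound: the answer to the query [n] ∖ {i} is YES exactly when i ∉ S, so the n
-- coatoms [n] ∖ {i} read off the hidden set S bit by bit.  Lower bound: the only query
-- telling the family {[n]} apart from {[n] ∖ {i}} is [n] ∖ {i} itself, so every
-- separating family, and every adaptive strategy run against {[n]}, must ask all n coatoms.
module Submission where

open import Defs
open import Data.Nat using (ℕ; _≤_; suc)
open import Data.Nat.Properties using (≤-reflexive; ≤-trans; module ≤-Reasoning)
open import Data.Bool using (true; false; _≟_)
open import Data.Bool.Properties using (∨-identityʳ)
open import Data.Fin using (Fin)
import Data.Fin.Properties as Fin
open import Data.Fin.Properties using (¬∀⟶∃¬; injective⇒≤)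
open import Data.Fin.Subset using (Subset; _⊆_; _∈_; _∉_; ⊤; ⁅_⁆; ∁)
open import Data.Fin.Subset.Properties
  using (_⊆?_; _∈?_; ⊆-trans; ⊆-antisym; ⊆⊤; ∈⊤; x∈⁅x⁆; x≢y⇒x∉⁅y⁆; x∈∁p⇒x∉p; x∉p⇒x∈∁p)
open import Data.List using (List; []; _∷_; length; map; allFin)
import Data.List as List
open import Data.List.Properties using (length-map; length-tabulate; ∷-injective)
import Data.List.Membership.Propositional as List
open import Data.List.Membership.Propositional.Properties using (∈-map⁺; ∈-allFin)
open import Data.List.Relation.Unary.Any using (here; there; index)
open import Data.List.Relation.Unary.Any.Properties using (lookup-index)
open import Data.List.Relation.Unary.Unique.Propositional using (Unique)
open import Data.List.Relation.Unary.Unique.Propositional.Properties using (map⁺; allFin⁺)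
import Data.List.Relation.Unary.All as All
import Data.List.Relation.Unary.AllPairs as AllPairs
open import Data.Product using (∃; _×_; _,_; proj₁; proj₂; map₁; map₂)
open import Function using (_∘_; case_of_)
open import Function.Bundles using (mk⇔; Equivalence)
open import Function.Definitions using (Injective)
open import Relation.Nullary using (¬_; Dec; yes; no; does; contradiction)
open import Relation.Binary.PropositionalEquality

private
  variable
    n : ℕ
    A B : Set
    i : Fin n
    S T G : Subset n
    F F' : Family n

does-≡⇒ : (a? : Dec A) (b? : Dec B) → does a? ≡ does b? → B → A
does-≡⇒ (yes a) _       _  _ = a
does-≡⇒ (no _)  (yes _) () _
does-≡⇒ (no _)  (no ¬b) _  b = contradiction b ¬b

does-≢⇒ : (A → B) → (a? : Dec A) (b? : Dec B) → does a? ≢ does b? → ¬ A × B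
does-≢⇒ _   (yes _) (yes _) ne = contradiction refl ne
does-≢⇒ a⇒b (yes a) (no ¬b) _  = contradiction (a⇒b a) ¬b
does-≢⇒ _   (no ¬a) (yes b) _  = ¬a , b
does-≢⇒ _   (no _)  (no _)  ne = contradiction refl ne

map-≡⇒≡ : ∀ {f g : A → B} xs {x} →
          map f xs ≡ map g xs → x List.∈ xs → f x ≡ g x
map-≡⇒≡ (_ ∷ _)  eq (here refl) = proj₁ (∷-injective eq)
map-≡⇒≡ (_ ∷ xs) eq (there x∈) = map-≡⇒≡ xs (proj₂ (∷-injective eq)) x∈

injective-∈⇒≤-length : ∀ {m} {f : Fin m → A} {xs : List A} →
                       Injective _≡_ _≡_ f → (∀ i → f i List.∈ xs) → m ≤ length xs
injective-∈⇒≤-length {f = f} {xs} f-inj f∈ = injective⇒≤ position-injective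
  where
  position-injective : ∀ {i j} → index (f∈ i) ≡ index (f∈ j) → i ≡ j
  position-injective {i} {j} eq = f-inj (begin
    f i                           ≡⟨ lookup-index (f∈ i) ⟩
    List.lookup xs (index (f∈ i)) ≡⟨ cong (List.lookup xs) eq ⟩
    List.lookup xs (index (f∈ j)) ≡⟨ lookup-index (f∈ j) ⟨
    f j                           ∎)
    where open ≡-Reasoning

coatom : Fin n → Subset n
coatom i = ∁ ⁅ i ⁆

∉-coatom : i ∉ coatom i
∉-coatom {i = i} i∈ = x∈∁p⇒x∉p i∈ (x∈⁅x⁆ i)

∈-coatom : ∀ {i j : Fin n} → j ≢ i → j ∈ coatom i
∈-coatom = x∉p⇒x∈∁p ∘ x≢y⇒x∉⁅y⁆

∉⇒⊆-coatom : i ∉ S → S ⊆ coatom i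
∉⇒⊆-coatom i∉S j∈S = ∈-coatom λ { refl → i∉S j∈S }

⊆-coatom⇒∉ : S ⊆ coatom i → i ∉ S
⊆-coatom⇒∉ S⊆ = ∉-coatom ∘ S⊆

coatom-injective : Injective _≡_ _≡_ (coatom {n})
coatom-injective {_} {i} {j} eq with i Fin.≟ j
... | yes i≡j = i≡j
... | no  i≢j = contradiction (subst (i ∈_) (sym eq) (∈-coatom i≢j)) ∉-coatom

⊤≢coatom : ⊤ ≢ coatom i
⊤≢coatom eq = ∉-coatom (subst (_ ∈_) eq ∈⊤)

-- T is the meet of the coatoms above it.
⊆-coatoms⇒⊆ : (∀ i → T ⊆ coatom i → S ⊆ coatom i) → S ⊆ T
⊆-coatoms⇒⊆ {T = T} above {x} x∈S with x ∈? T
... | yes x∈T = x∈T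
... | no  x∉T = contradiction x∈S (⊆-coatom⇒∉ (above x (∉⇒⊆-coatom x∉T)))

coatom-maximal : coatom i ⊆ G → ¬ ⊤ ⊆ G → G ≡ coatom i
coatom-maximal {i = i} {G = G} coatom⊆G ⊤⊈G = ⊆-antisym (∉⇒⊆-coatom i∉G) coatom⊆G
  where
  i∉G : i ∉ G
  i∉G i∈G = ⊤⊈G λ {x} _ → case x Fin.≟ i of λ where
    (yes refl) → i∈G
    (no  x≢i)  → coatom⊆G (∈-coatom x≢i)

coatoms : ∀ n → Family n
coatoms n = map coatom (allFin n)

coatom∈coatoms : ∀ i → coatom i List.∈ coatoms n
coatom∈coatoms i = ∈-map⁺ coatom (∈-allFin i)

length-coatoms : length (coatoms n) ≡ n
length-coatoms {n} = trans (length-map coatom (allFin n)) (length-tabulate _)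

coatoms-unique : Unique (coatoms n)
coatoms-unique {n} = map⁺ coatom-injective (allFin⁺ n)

Separates : Subset n → Family n → Family n → Set
Separates G F F' = answer F G ≢ answer F' G

answer-singleton : ∀ (S Q : Subset n) → answer (S ∷ []) Q ≡ does (S ⊆? Q)
answer-singleton S Q = ∨-identityʳ (does (S ⊆? Q))

singleton-antichain : IsKAntichain 1 (S ∷ [])
singleton-antichain =
  All.[] AllPairs.∷ AllPairs.[] , refl , λ { (here refl) (here refl) _ → refl }

1-antichain⇒singleton : IsKAntichain 1 F → ∃ λ S → F ≡ S ∷ []
1-antichain⇒singleton {F = S ∷ []} _ = S , refl

≈F-singleton⇒≡ : (S ∷ []) ≈F (T ∷ []) → S ≡ T
≈F-singleton⇒≡ {S = S} S≈T with Equivalence.to (S≈T S) (here refl)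
... | here S≡T = S≡T

coatom-answers-determine-singleton :
  (∀ i → answer (S ∷ []) (coatom i) ≡ answer (T ∷ []) (coatom i)) → S ≡ T
coatom-answers-determine-singleton {S = S} {T} same =
  ⊆-antisym (⊆-coatoms⇒⊆ λ i → does-≡⇒ (S ⊆? coatom i) (T ⊆? coatom i) (agree i))
            (⊆-coatoms⇒⊆ λ i → does-≡⇒ (T ⊆? coatom i) (S ⊆? coatom i) (sym (agree i)))
  where
  agree : ∀ i → does (S ⊆? coatom i) ≡ does (T ⊆? coatom i)
  agree i = trans (sym (answer-singleton S (coatom i)))
                  (trans (same i) (answer-singleton T (coatom i)))

coatom-answers-determine-1-antichain : IsKAntichain 1 F → IsKAntichain 1 F' →
  (∀ i → answer F (coatom i) ≡ answer F' (coatom i)) → F ≈F F'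
coatom-answers-determine-1-antichain F-anti F'-anti same
  with 1-antichain⇒singleton F-anti | 1-antichain⇒singleton F'-anti
... | S , refl | T , refl with coatom-answers-determine-singleton {S = S} {T = T} same
... | refl = λ _ → mk⇔ (λ x → x) (λ x → x)

separates-⊤-coatom⇒≡ : Separates G (⊤ ∷ []) (coatom i ∷ []) → G ≡ coatom i
separates-⊤-coatom⇒≡ {G = G} {i} ne =
  let ⊤⊈G , coatom⊆G = does-≢⇒ (⊆-trans ⊆⊤) (⊤ ⊆? G) (coatom i ⊆? G)
                         (subst₂ _≢_ (answer-singleton ⊤ G) (answer-singleton (coatom i) G) ne)
  in coatom-maximal coatom⊆G ⊤⊈G

⊤-coatom-separators⇒≤ : (Qs : Family n) →
  (∀ i → ∃ λ G → G List.∈ Qs × Separates G (⊤ ∷ []) (coatom i ∷ [])) → n ≤ length Qs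
⊤-coatom-separators⇒≤ Qs separator = injective-∈⇒≤-length coatom-injective coatom∈Qs
  where
  coatom∈Qs : ∀ i → coatom i List.∈ Qs
  coatom∈Qs i with separator i
  ... | G , G∈Qs , ne = subst (List._∈ Qs) (separates-⊤-coatom⇒≡ ne) G∈Qs

⊤≉Fcoatom : ¬ (⊤ ∷ []) ≈F (coatom i ∷ [])
⊤≉Fcoatom = ⊤≢coatom ∘ ≈F-singleton⇒≡

askAll : Family n → Strategy n
askAll []       = stop
askAll (Q ∷ Qs) = ask Q (askAll Qs) (askAll Qs)

run-askAll : ∀ (Qs : Family n) F → run (askAll Qs) F ≡ map (answer F) Qs
run-askAll []       F = refl
run-askAll (Q ∷ Qs) F with answer F Q
... | true  = cong (true ∷_) (run-askAll Qs F)
... | false = cong (false ∷_) (run-askAll Qs F)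

queries : Strategy n → Family n → Family n
queries stop        F = []
queries (ask Q y m) F with answer F Q
... | true  = Q ∷ queries y F
... | false = Q ∷ queries m F

length-queries : ∀ (t : Strategy n) F → length (queries t F) ≡ length (run t F)
length-queries stop        F = refl
length-queries (ask Q y m) F with answer F Q
... | true  = cong suc (length-queries y F)
... | false = cong suc (length-queries m F)

run-≢⇒separating-query : ∀ (t : Strategy n) → run t F ≢ run t F' →
  ∃ λ G → G List.∈ queries t F × Separates G F F'
run-≢⇒separating-query stop ne = contradiction refl ne
run-≢⇒separating-query {F = F} {F'} (ask Q y m) ne
  with answer F Q in eq | answer F' Q in eq'
... | true  | true  = map₂ (map₁ there) (run-≢⇒separating-query y (ne ∘ cong (true ∷_)))
... | false | false = map₂ (map₁ there) (run-≢⇒separating-query m (ne ∘ cong (false ∷_)))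
... | true  | false = Q , here refl , λ e → contradiction (trans (sym eq) (trans e eq')) λ ()
... | false | true  = Q , here refl , λ e → contradiction (trans (sym eq) (trans e eq')) λ ()

coatom-strategy-solves : AdaptiveSolves n 1 n (askAll (coatoms n))
coatom-strategy-solves {n} = asks-n , determines
  where
  asks-n : ∀ F → IsKAntichain 1 F → length (run (askAll (coatoms n)) F) ≤ n
  asks-n F _ = ≤-reflexive (begin
    length (run (askAll (coatoms n)) F)  ≡⟨ cong length (run-askAll (coatoms n) F) ⟩
    length (map (answer F) (coatoms n))  ≡⟨ length-map (answer F) (coatoms n) ⟩
    length (coatoms n)                   ≡⟨ length-coatoms ⟩
    n                                    ∎)
    where open ≡-Reasoning
  determines : ∀ F F' → IsKAntichain 1 F → IsKAntichain 1 F' →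
               run (askAll (coatoms n)) F ≡ run (askAll (coatoms n)) F' → F ≈F F'
  determines F F' F-anti F'-anti same-run =
    coatom-answers-determine-1-antichain F-anti F'-anti λ i →
      map-≡⇒≡ (coatoms n) same-answers (coatom∈coatoms i)
    where
    same-answers : map (answer F) (coatoms n) ≡ map (answer F') (coatoms n)
    same-answers = trans (sym (run-askAll (coatoms n) F))
                         (trans same-run (run-askAll (coatoms n) F'))

coatoms-separating : Separating n 1 (coatoms n)
coatoms-separating {n} H H' H-anti H'-anti H≉H'
  with ¬∀⟶∃¬ n (λ i → answer H (coatom i) ≡ answer H' (coatom i))
               (λ i → answer H (coatom i) ≟ answer H' (coatom i))
               (H≉H' ∘ coatom-answers-determine-1-antichain H-anti H'-anti)
... | i , differ = coatom i , coatom∈coatoms i , differ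

adaptive-≥ : ∀ {q} → AdaptiveOK n 1 q → n ≤ q
adaptive-≥ (t , asks-≤q , determines) = begin
  _                              ≤⟨ ⊤-coatom-separators⇒≤ (queries t (⊤ ∷ [])) separator ⟩
  length (queries t (⊤ ∷ []))    ≡⟨ length-queries t (⊤ ∷ []) ⟩
  length (run t (⊤ ∷ []))        ≤⟨ asks-≤q (⊤ ∷ []) singleton-antichain ⟩
  _                              ∎
  where
  open ≤-Reasoning
  separator : ∀ i → ∃ λ G → G List.∈ queries t (⊤ ∷ []) × Separates G (⊤ ∷ []) (coatom i ∷ [])
  separator i = run-≢⇒separating-query t
    (⊤≉Fcoatom {i = i} ∘ determines _ _ singleton-antichain singleton-antichain)

nonadaptive-≥ : ∀ {q} → NonAdaptiveOK n 1 q → n ≤ q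
nonadaptive-≥ (𝒢 , _ , length≡q , separating) =
  ≤-trans (⊤-coatom-separators⇒≤ 𝒢 λ i →
             separating _ _ singleton-antichain singleton-antichain (⊤≉Fcoatom {i = i}))
          (≤-reflexive length≡q)

proposition1p1 : ∀ (n : ℕ) → 1 ≤ n → f-is n 1 n × h-is n 1 n
proposition1p1 n _ =
  ((askAll (coatoms n) , coatom-strategy-solves) , λ _ → adaptive-≥)
  , ((coatoms n , coatoms-unique , length-coatoms , coatoms-separating) , λ _ → nonadaptive-≥)
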